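{- Let $G$ be a connected graph and $H$ a graph, and let $D$ be a total $[1,2]$-set of $G\circ H$. If there is a vertex $v\in V(G)$ such that $D$ contains more than two vertices of $H^v=\{(v,h):h\in V(H)\}$, then $G=K_1$ and $H$ has a total $[1,2]$-set.
   Context: All graphs are finite and simple. The lexicographic product $G\circ H$ has vertex set $V(G)\times V(H)$, and $(g,h)$ is adjacent to $(g',h')$ if and only if either $\{g,g'\}\in E(G)$, or $g=g'$ and $\{h,h'\}\in E(H)$. A set $S$ of vertices of a graph $X$ is a total $[1,2]$-set of $X$ if every vertex $x$ of $X$ satisfies $1\leq |N_X(x)\cap S|\leq 2$, where $N_X(x)$ is the open neighborhood. -}

module Defs where

open import Data.Nat using (ℕ; _*_; _+_)
open import Data.Bool using (Bool; true; false; _∧_; _∨_; if_then_else_)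
open import Data.Fin using (Fin; combine; remQuot)
open import Data.Fin.Properties using (_≟_)
open import Data.List using (List; map)
open import Data.Nat.ListAction using (sum)
open import Data.Fin.Base using ()
open import Data.List using (allFin)
open import Data.Product using (_×_; _,_)
open import Relation.Nullary.Decidable using (⌊_⌋)
open import Relation.Binary.PropositionalEquality using (_≡_; refl) renaming (sym to ≡-sym)
open import Relation.Nullary using (yes; no)
open import Data.Empty using (⊥-elim)
open import Relation.Binary.Construct.Closure.ReflexiveTransitive using (Star)

record Graph : Set where
  field
    n      : ℕ
    adj    : Fin n → Fin n → Bool
    sym    : ∀ u v → adj u v ≡ adj v u
    irrefl : ∀ v → adj v v ≡ false
open Graph public

Adj : (X : Graph) → Fin (n X) → Fin (n X) → Set
Adj X u v = adj X u v ≡ true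

Connected : Graph → Set
Connected X = ∀ (u v : Fin (n X)) → Star (Adj X) u v

VSet : Graph → Set
VSet X = Fin (n X) → Bool

count : ∀ {k} → (Fin k → Bool) → ℕ
count {k} P = sum (map (λ i → if P i then 1 else 0) (allFin k))

nbrCount : (X : Graph) → VSet X → Fin (n X) → ℕ
nbrCount X S x = count (λ y → adj X x y ∧ S y)

Total12 : (X : Graph) → VSet X → Set
Total12 X S = ∀ x → (1 Data.Nat.≤ nbrCount X S x) × (nbrCount X S x Data.Nat.≤ 2)

lexAdjPair : (G H : Graph) → Fin (n G) × Fin (n H) → Fin (n G) × Fin (n H) → Bool
lexAdjPair G H (g , h) (g' , h') = adj G g g' ∨ (⌊ g ≟ g' ⌋ ∧ adj H h h')

lexAdj : (G H : Graph) → Fin (n G * n H) → Fin (n G * n H) → Bool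
lexAdj G H i j = lexAdjPair G H (remQuot (n H) i) (remQuot (n H) j)

private
  eqb-sym : ∀ {k} (a b : Fin k) → ⌊ a ≟ b ⌋ ≡ ⌊ b ≟ a ⌋
  eqb-sym a b with a ≟ b | b ≟ a
  ... | yes _ | yes _ = refl
  ... | no _ | no _ = refl
  ... | yes p | no q = ⊥-elim (q (≡-sym p))
  ... | no p | yes q = ⊥-elim (p (≡-sym q))

  eqb-refl : ∀ {k} (a : Fin k) → ⌊ a ≟ a ⌋ ≡ true
  eqb-refl a with a ≟ a
  ... | yes _ = refl
  ... | no p = ⊥-elim (p refl)

  pair-sym : (G H : Graph) → ∀ p q → lexAdjPair G H p q ≡ lexAdjPair G H q p
  pair-sym G H (g , h) (g' , h')
    rewrite sym G g g' | eqb-sym g g' | sym H h h' = refl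

  pair-irrefl : (G H : Graph) → ∀ p → lexAdjPair G H p p ≡ false
  pair-irrefl G H (g , h) rewrite irrefl G g | eqb-refl g | irrefl H h = refl

-- The lexicographic product G ∘ H, with vertex (g , h) encoded as combine g h.
_∘L_ : Graph → Graph → Graph
G ∘L H = record
  { n = n G * n H
  ; adj = lexAdj G H
  ; sym = λ i j → pair-sym G H (remQuot (n H) i) (remQuot (n H) j)
  ; irrefl = λ i → pair-irrefl G H (remQuot (n H) i)
  }

fiber : (G H : Graph) → Fin (n G) → Fin (n H) → Fin (n (G ∘L H))
fiber G H v h = combine v h

module Submission where

-- If w is a neighbour of v in G, then every vertex of H^v is a
-- neighbour of each vertex (w , h) of G ∘ H, so (w , h) would see more than
-- two vertices of D.  Hence v is isolated in G, and a connected graph with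
-- an isolated vertex has exactly one vertex.  Moreover, when v is isolated
-- the neighbourhood of (v , h) in G ∘ H is exactly the copy of the
-- neighbourhood of h in H, so D restricted to H^v is a total [1,2]-set of H.

open import Defs
open import Data.Nat using (ℕ; _<_)
open import Data.Fin using (Fin)
open import Data.Product using (_×_; Σ)
open import Relation.Binary.PropositionalEquality using (_≡_)

open import Data.Nat using (zero; suc; _+_; _*_; _≤_; z≤n; s≤s)
open import Data.Nat.Properties as ℕₚ
  using (≤-trans; m≤m+n; m≤n+m; +-identityʳ; +-assoc; <-irrefl; +-0-monoid)
open import Data.Fin using (zero; suc; combine; _↑ˡ_; _↑ʳ_)
open import Data.Fin.Properties using (remQuot-combine; suc-injective; _≟_)
open import Data.Bool using (Bool; true; false; _∧_; _∨_; if_then_else_)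
open import Data.Bool.Properties using (¬-not)
open import Data.List using (tabulate)
open import Data.List.Properties using (map-tabulate)
import Data.Nat.ListAction as List
open import Data.Product using (_,_; proj₁; proj₂)
open import Relation.Binary.PropositionalEquality
  using (refl; cong; cong₂; trans; subst; module ≡-Reasoning) renaming (sym to ≡-sym)
open import Relation.Nullary using (¬_)
open import Relation.Nullary.Decidable using (⌊_⌋; isYes≗does; dec-true; dec-false)
open import Relation.Binary.Construct.Closure.ReflexiveTransitive using (Star; ε; _◅_)
open import Function using (_∘_)
open import Algebra.Properties.Monoid.Sum +-0-monoid
  using (sum-cong-≗; sum-replicate-zero; sum-syntax) renaming (sum to ∑)

indicator : Bool → ℕ
indicator b = if b then 1 else 0

count-as-∑ : ∀ {k} (P : Fin k → Bool) → count P ≡ ∑[ i < k ] indicator (P i)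
count-as-∑ P =
  trans (cong List.sum (map-tabulate (λ i → i) (indicator ∘ P))) (sum-tabulate (indicator ∘ P))
  where
  sum-tabulate : ∀ {m} (f : Fin m → ℕ) → List.sum (tabulate f) ≡ ∑ f
  sum-tabulate {zero}  f = refl
  sum-tabulate {suc m} f = cong (f zero +_) (sum-tabulate (f ∘ suc))

∑-↑ : ∀ a b (f : Fin (a + b) → ℕ) → ∑ f ≡ ∑ (λ i → f (i ↑ˡ b)) + ∑ (λ j → f (a ↑ʳ j))
∑-↑ zero    b f = refl
∑-↑ (suc a) b f =
  trans (cong (f zero +_) (∑-↑ a b (f ∘ suc))) (≡-sym (+-assoc (f zero) _ _))

∑-combine : ∀ m k (f : Fin (m * k) → ℕ) →
  ∑ f ≡ ∑[ g < m ] ∑[ h < k ] f (combine g h)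
∑-combine zero    k f = refl
∑-combine (suc m) k f =
  trans (∑-↑ k (m * k) f) (cong (∑ (λ h → f (combine {suc m} zero h)) +_) (∑-combine m k (f ∘ (k ↑ʳ_))))

term≤∑ : ∀ {k} (f : Fin k → ℕ) i → f i ≤ ∑ f
term≤∑ f zero    = m≤m+n _ _
term≤∑ f (suc i) = ≤-trans (term≤∑ (f ∘ suc) i) (m≤n+m _ _)

∑-single : ∀ {k} (f : Fin k → ℕ) v → (∀ i → ¬ i ≡ v → f i ≡ 0) → ∑ f ≡ f v
∑-single {suc k} f zero others = begin
  f zero + ∑ (f ∘ suc)     ≡⟨ cong (f zero +_) (sum-cong-≗ (λ i → others (suc i) (λ ()))) ⟩
  f zero + ∑ {k} (λ _ → 0) ≡⟨ cong (f zero +_) (sum-replicate-zero k) ⟩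
  f zero + 0               ≡⟨ +-identityʳ _ ⟩
  f zero                   ∎
  where open ≡-Reasoning
∑-single f (suc v) others rewrite others zero (λ ()) =
  ∑-single (f ∘ suc) v (λ i i≢v → others (suc i) (i≢v ∘ suc-injective))

index-of-positive-∑ : ∀ {k} (f : Fin k → ℕ) → 0 < ∑ f → Fin k
index-of-positive-∑ {zero}  f ()
index-of-positive-∑ {suc k} f _ = zero

Fin-singleton : ∀ {k} (v : Fin k) → (∀ u → u ≡ v) → k ≡ 1
Fin-singleton {suc zero}    _       _    = refl
Fin-singleton {suc (suc k)} zero    only with only (suc zero)
... | ()
Fin-singleton {suc (suc k)} (suc v) only with only zero
... | ()

≟-refl : ∀ {k} (a : Fin k) → ⌊ a ≟ a ⌋ ≡ true
≟-refl a = trans (isYes≗does (a ≟ a)) (dec-true (a ≟ a) refl)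

≟-distinct : ∀ {k} (a b : Fin k) → ¬ b ≡ a → ⌊ a ≟ b ⌋ ≡ false
≟-distinct a b b≢a = trans (isYes≗does (a ≟ b)) (dec-false (a ≟ b) (b≢a ∘ ≡-sym))

Isolated : (X : Graph) → Fin (n X) → Set
Isolated X v = ∀ w → adj X v w ≡ false

walk-from-isolated : (X : Graph) {v u : Fin (n X)} → Isolated X v → Star (Adj X) v u → u ≡ v
walk-from-isolated X iso ε               = refl
walk-from-isolated X iso (v~w ◅ _) with () ← trans (≡-sym (iso _)) v~w

connected-isolated⇒K₁ : (X : Graph) → Connected X → (v : Fin (n X)) → Isolated X v → n X ≡ 1
connected-isolated⇒K₁ X conn v iso =
  Fin-singleton v (λ u → walk-from-isolated X iso (conn v u))

module _ (G H : Graph) (D : VSet (G ∘L H)) where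

  restrict : Fin (n G) → VSet H
  restrict v h = D (fiber G H v h)

  nbrCount-∘L : ∀ w h → nbrCount (G ∘L H) D (fiber G H w h) ≡
    ∑[ g < n G ] ∑[ h' < n H ] indicator (lexAdjPair G H (w , h) (g , h') ∧ restrict g h')
  nbrCount-∘L w h = begin
    nbrCount (G ∘L H) D (fiber G H w h)
      ≡⟨ count-as-∑ (λ y → lexAdj G H (combine w h) y ∧ D y) ⟩
    ∑ (λ y → indicator (lexAdj G H (combine w h) y ∧ D y))
      ≡⟨ ∑-combine (n G) (n H) _ ⟩
    ∑[ g < n G ] ∑[ h' < n H ] indicator (lexAdj G H (combine w h) (combine g h') ∧ restrict g h')
      ≡⟨ sum-cong-≗ (λ g → sum-cong-≗ (λ h' → cong₂ (λ p q → indicator (lexAdjPair G H p q ∧ restrict g h'))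
                                                       (remQuot-combine w h) (remQuot-combine g h'))) ⟩
    ∑[ g < n G ] ∑[ h' < n H ] indicator (lexAdjPair G H (w , h) (g , h') ∧ restrict g h')
      ∎
    where open ≡-Reasoning

  -- If w ~ v in G, every vertex of H^v is a neighbour of (w , h), so the
  -- D-neighbours of (w , h) include all of D ∩ H^v.
  fibre-count≤nbrCount : ∀ {v w} → Adj G w v → ∀ h →
    count (restrict v) ≤ nbrCount (G ∘L H) D (fiber G H w h)
  fibre-count≤nbrCount {v} {w} w~v h = begin
    count (restrict v)
      ≡⟨ count-as-∑ (restrict v) ⟩
    ∑[ h' < n H ] indicator (restrict v h')
      ≡⟨ sum-cong-≗ (λ h' → cong (λ b → indicator ((b ∨ (⌊ w ≟ v ⌋ ∧ adj H h h')) ∧ restrict v h')) w~v) ⟨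
    row v
      ≤⟨ term≤∑ row v ⟩
    ∑ row
      ≡⟨ nbrCount-∘L w h ⟨
    nbrCount (G ∘L H) D (fiber G H w h)
      ∎
    where
    open ℕₚ.≤-Reasoning
    row : Fin (n G) → ℕ
    row g = ∑[ h' < n H ] indicator (lexAdjPair G H (w , h) (g , h') ∧ restrict g h')

  -- If v is isolated, the neighbours of (v , h) are exactly the (v , h')
  -- with h ~ h' in H.
  isolated-nbrCount : ∀ {v} → Isolated G v → ∀ h →
    nbrCount (G ∘L H) D (fiber G H v h) ≡ nbrCount H (restrict v) h
  isolated-nbrCount {v} iso h = begin
    nbrCount (G ∘L H) D (fiber G H v h)
      ≡⟨ nbrCount-∘L v h ⟩
    ∑ row
      ≡⟨ ∑-single row v other-rows-vanish ⟩
    row v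
      ≡⟨ sum-cong-≗ (λ h' → cong₂ (λ a e → indicator ((a ∨ (e ∧ adj H h h')) ∧ restrict v h'))
                                  (irrefl G v) (≟-refl v)) ⟩
    ∑[ h' < n H ] indicator (adj H h h' ∧ restrict v h')
      ≡⟨ count-as-∑ (λ h' → adj H h h' ∧ restrict v h') ⟨
    nbrCount H (restrict v) h
      ∎
    where
    open ≡-Reasoning
    row : Fin (n G) → ℕ
    row g = ∑[ h' < n H ] indicator (lexAdjPair G H (v , h) (g , h') ∧ restrict g h')
    other-rows-vanish : ∀ g → ¬ g ≡ v → row g ≡ 0
    other-rows-vanish g g≢v = trans
      (sum-cong-≗ (λ h' → cong₂ (λ a e → indicator ((a ∨ (e ∧ adj H h h')) ∧ restrict g h'))
                                (iso g) (≟-distinct v g g≢v)))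
      (sum-replicate-zero (n H))

  heavy-fibre⇒isolated : Total12 (G ∘L H) D → ∀ v → 2 < count (restrict v) → Isolated G v
  heavy-fibre⇒isolated total v heavy w = ¬-not v≁w
    where
    heavy′ : 2 < ∑[ h < n H ] indicator (restrict v h)
    heavy′ = subst (2 <_) (count-as-∑ (restrict v)) heavy
    h : Fin (n H)
    h = index-of-positive-∑ _ (≤-trans (s≤s z≤n) heavy′)
    v≁w : ¬ adj G v w ≡ true
    v≁w v~w = <-irrefl refl (≤-trans heavy
      (≤-trans (fibre-count≤nbrCount (trans (sym G w v) v~w) h) (proj₂ (total (fiber G H w h)))))

  isolated-restrict-Total12 : Total12 (G ∘L H) D → ∀ {v} → Isolated G v → Total12 H (restrict v)
  isolated-restrict-Total12 total iso h =
    subst (1 ≤_) same (proj₁ (total (fiber G H _ h))) , subst (_≤ 2) same (proj₂ (total (fiber G H _ h)))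
    where same = isolated-nbrCount iso h

lemma4p4 : (G H : Graph) → Connected G → (D : VSet (G ∘L H)) → Total12 (G ∘L H) D →
    (v : Fin (n G)) → 2 < count (λ h → D (fiber G H v h)) →
    (n G ≡ 1) × (Σ (VSet H) (λ S → Total12 H S))
lemma4p4 G H conn D total v heavy =
  connected-isolated⇒K₁ G conn v v-isolated ,
  restrict G H D v , isolated-restrict-Total12 G H D total v-isolated
  where
  v-isolated : Isolated G v
  v-isolated = heavy-fibre⇒isolated G H D total v heavy
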